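{- Let $n\ge1$ and let $S$ be an admissible subset of $\{r,b,g,y,o,s\}$ with $g\in S$. Then there is a bijection between $Y_n(S)$ and $J(T_n(S))$ such that for $y\in Y_n(S)$ corresponding to $I\in J(T_n(S))$, $\sum_{i=1}^{n-1}\sum_{j=1}^{n-i}(y_{i,j}-i)=|I|$.
   Context: For an integer $n\ge1$, let $T_n$ be the set of triples $(c_1,c_2,c_3)$ of nonnegative integers with $c_1+c_2+c_3\le n-2$. Six colors are associated to vectors: red $r=(1,0,0)$, green $g=(0,1,0)$, yellow $y=(0,0,1)$, blue $b=(-1,1,0)$, orange $o=(-1,0,1)$, silver $s=(0,1,-1)$. For $S\subseteq\{r,b,g,o,y,s\}$, $T_n(S)$ is the poset on $T_n$ whose order relation is the reflexive–transitive closure of the relations $u<u+v$ for all $u,u+v\in T_n$ and $v$ the vector of a color in $S$. $S$ is admissible if: $\{r,b\}\subseteq S\Rightarrow g\in S$; $\{o,s\}\subseteq S\Rightarrow b\in S$; $\{s,y\}\subseteq S\Rightarrow g\in S$; $\{r,o\}\subseteq S\Rightarrow y\in S$. $J(P)$ is the set of order ideals of a poset $P$. For admissible $S$ with $g\in S$, $Y_n(S)$ is the set of integer arrays $y=(y_{i,j})$ indexed by $1\le i\le n-1$, $1\le j\le n-i$, with $i\le y_{i,j}\le i+j$ for all entries, and satisfying, whenever both entries involved are defined, the following conditions for the colors in $S$: orange: $y_{i,j}<y_{i+1,j}$; red: $y_{i,j}\le y_{i-1,j+1}+1$; yellow: $y_{i,j}\le y_{i,j+1}$; blue: $y_{i,j}\le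 y_{i+1,j-1}$; silver: $y_{i,j}\le y_{i,j-1}+1$. -}

module Defs where

open import Level using (0ℓ)
open import Data.Bool using (Bool; true; false; _∧_; if_then_else_)
open import Data.Nat using (ℕ; zero; suc; _+_; _∸_; _≤_; _<_; _≤ᵇ_)
open import Data.Integer as ℤ using (ℤ; +_)
open import Data.List using (List; map; upTo)
open import Data.Nat.ListAction using (sum)
open import Data.Product using (Σ; _×_; _,_; proj₁)
open import Relation.Binary.PropositionalEquality using (_≡_; refl; sym; trans)
open import Relation.Binary.Bundles using (Setoid)
open import Relation.Binary.Structures using (IsEquivalence)
open import Relation.Binary.Construct.Closure.ReflexiveTransitive using (Star)

data Color : Set where
  r g y b o s : Color

Vec3ℤ : Set
Vec3ℤ = ℤ × ℤ × ℤ

vec : Color → Vec3ℤ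
vec r = (+ 1 , + 0 , + 0)
vec g = (+ 0 , + 1 , + 0)
vec y = (+ 0 , + 0 , + 1)
vec b = (ℤ.- (+ 1) , + 1 , + 0)
vec o = (ℤ.- (+ 1) , + 0 , + 1)
vec s = (+ 0 , + 1 , ℤ.- (+ 1))

ColorSet : Set
ColorSet = Color → Bool

_∈S_ : Color → ColorSet → Set
c ∈S S = S c ≡ true

Admissible : ColorSet → Set
Admissible S =
    (r ∈S S → b ∈S S → g ∈S S)
  × (o ∈S S → s ∈S S → b ∈S S)
  × (s ∈S S → y ∈S S → g ∈S S)
  × (r ∈S S → o ∈S S → y ∈S S)

Triple : Set
Triple = ℕ × ℕ × ℕ

-- (c1,c2,c3) ∈ T_n  iff  c1+c2+c3 ≤ n-2  (integer subtraction; i.e. c1+c2+c3+2 ≤ n)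
InT : ℕ → Triple → Set
InT n (c₁ , c₂ , c₃) = c₁ + c₂ + c₃ + 2 ≤ n

IsSum : Triple → Vec3ℤ → Triple → Set
IsSum (u₁ , u₂ , u₃) (v₁ , v₂ , v₃) (w₁ , w₂ , w₃) =
  (+ w₁ ≡ + u₁ ℤ.+ v₁) × (+ w₂ ≡ + u₂ ℤ.+ v₂) × (+ w₃ ≡ + u₃ ℤ.+ v₃)

Cover : ColorSet → ℕ → Triple → Triple → Set
Cover S n u w = InT n u × InT n w × Σ Color (λ c → c ∈S S × IsSum u (vec c) w)

_≼[_,_]_ : Triple → ColorSet → ℕ → Triple → Set
u ≼[ S , n ] w = Star (Cover S n) u w

-- order ideals of T_n(S), as decidable (Bool-valued) subsets of T_n;
-- values outside T_n are irrelevant (see the setoid equality below)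
IsIdeal : ColorSet → ℕ → (Triple → Bool) → Set
IsIdeal S n I = ∀ u w → InT n u → InT n w → u ≼[ S , n ] w → I w ≡ true → I u ≡ true

J-Setoid : ColorSet → ℕ → Setoid 0ℓ 0ℓ
J-Setoid S n = record
  { Carrier = Σ (Triple → Bool) (IsIdeal S n)
  ; _≈_ = λ I I′ → ∀ u → InT n u → proj₁ I u ≡ proj₁ I′ u
  ; isEquivalence = record
    { refl = λ u _ → refl
    ; sym = λ p u h → sym (p u h)
    ; trans = λ p q u h → trans (p u h) (q u h)
    }
  }

-- |I| : number of elements of T_n lying in I
-- (every element of T_n has all coordinates < n)
card : ℕ → (Triple → Bool) → ℕ
card n I = sum (map (λ a → sum (map (λ c₂ → sum (map (λ c₃ →
  if ((a + c₂ + c₃ + 2) ≤ᵇ n) ∧ I (a , c₂ , c₃) then 1 else 0)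
  (upTo n))) (upTo n))) (upTo n))

Array : Set
Array = ℕ → ℕ → ℕ

InDom : ℕ → ℕ → ℕ → Set
InDom n i j = 1 ≤ i × 1 ≤ j × i + j ≤ n

InY : ColorSet → ℕ → Array → Set
InY S n Y =
    (∀ i j → InDom n i j → i ≤ Y i j × Y i j ≤ i + j)
  × (o ∈S S → ∀ i j → InDom n i j → InDom n (suc i) j → Y i j < Y (suc i) j)
  -- red: y_{i,j} ≤ y_{i-1,j+1} + 1   (written with i := i+1)
  × (r ∈S S → ∀ i j → InDom n (suc i) j → InDom n i (suc j) → Y (suc i) j ≤ Y i (suc j) + 1)
  × (y ∈S S → ∀ i j → InDom n i j → InDom n i (suc j) → Y i j ≤ Y i (suc j))
  -- blue: y_{i,j} ≤ y_{i+1,j-1}   (written with j := j+1)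
  × (b ∈S S → ∀ i j → InDom n i (suc j) → InDom n (suc i) j → Y i (suc j) ≤ Y (suc i) j)
  -- silver: y_{i,j} ≤ y_{i,j-1} + 1   (written with j := j+1)
  × (s ∈S S → ∀ i j → InDom n i (suc j) → InDom n i j → Y i (suc j) ≤ Y i j + 1)

Y-Setoid : ColorSet → ℕ → Setoid 0ℓ 0ℓ
Y-Setoid S n = record
  { Carrier = Σ Array (InY S n)
  ; _≈_ = λ Y Y′ → ∀ i j → InDom n i j → proj₁ Y i j ≡ proj₁ Y′ i j
  ; isEquivalence = record
    { refl = λ i j _ → refl
    ; sym = λ p i j h → sym (p i j h)
    ; trans = λ p q i j h → trans (p i j h) (q i j h)
    }
  }

Σ[1‥_] : ℕ → (ℕ → ℕ) → ℕ
Σ[1‥ m ] f = sum (map (λ k → f (suc k)) (upTo m))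

stat : ℕ → Array → ℕ
stat n Y = Σ[1‥ n ∸ 1 ] (λ i → Σ[1‥ n ∸ i ] (λ j → Y i j ∸ i))

module Submission where

-- Over each cell (i , j) of the triangular array sits the fibre {(i - 1 , k , n - i - j) | k < j}
-- of T_n, and these fibres partition T_n. Since g ∈ S, an order ideal meets every fibre in an
-- initial segment {k < h(i , j)}, so it is determined by the heights 0 ≤ h(i , j) ≤ j; put
-- y(i , j) = i + h(i , j). Every other colour moves a fibre onto a neighbouring one, shifting k
-- by 0 or 1, and closure of the ideal under that move is exactly the corresponding inequality
-- between neighbouring entries of y. Summing the heights gives |I| = Σ (y(i , j) - i).

open import Defs
open import Data.Bool using (Bool; true; false; _∧_; if_then_else_)
open import Data.Bool.Properties using (T-≡)
import Data.Integer as ℤ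
open import Data.List using (map; applyUpTo; upTo)
open import Data.Nat using (ℕ; zero; suc; _+_; _∸_; _≤_; _<_; _≤ᵇ_; _<ᵇ_; z≤n; s≤s; z<s; s<s)
open import Data.Nat.ListAction using (sum)
open import Data.Nat.Properties
open import Data.Nat.Tactic.RingSolver using (solve-∀)
open import Data.Product using (Σ; _×_; _,_; proj₁; proj₂)
open import Function using (_∘_; id)
open import Function.Bundles using (Bijection; Inverse; Equivalence)
open import Function.Definitions using (Inverseˡ; Inverseʳ)
open import Function.Properties.Inverse using (Inverse⇒Bijection)
open import Relation.Binary.Bundles using (Setoid)
open import Relation.Binary.Construct.Closure.ReflexiveTransitive using (ε; _◅_)
open import Relation.Binary.PropositionalEquality
open import Relation.Nullary.Decidable using (dec-true; dec-false)
open import Relation.Nullary.Negation using (¬_)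

private
  variable
    a c k m n : ℕ
    col : Color
    S : ColorSet
    u w : Triple
    Y : Array
    I : Triple → Bool

<∸⇒+< : ∀ m {k n} → k < n ∸ m → m + k < n
<∸⇒+< zero              k<n   = k<n
<∸⇒+< (suc m) {n = suc n} k<n∸m = s<s (<∸⇒+< m k<n∸m)

∸-suc : m < n → n ∸ m ≡ suc (n ∸ suc m)
∸-suc {n = suc n} (s≤s m≤n) = +-∸-assoc 1 m≤n

∸-≤-suc∸suc : ∀ {x x′} m → x ≤ x′ → x ∸ m ≤ suc (x′ ∸ suc m)
∸-≤-suc∸suc {x} {x′} m x≤x′ = m≤n+o⇒m∸n≤o x m (begin
  x                        ≤⟨ x≤x′ ⟩
  x′                       ≤⟨ m≤n+m∸n x′ (suc m) ⟩
  suc m + (x′ ∸ suc m)     ≡⟨ sym (+-suc m _) ⟩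
  m + suc (x′ ∸ suc m)     ∎)
  where open ≤-Reasoning

<ᵇ-true⇒< : (m <ᵇ n) ≡ true → m < n
<ᵇ-true⇒< {m} {n} e = <ᵇ⇒< m n (Equivalence.from T-≡ e)

<⇒<ᵇ-true : m < n → (m <ᵇ n) ≡ true
<⇒<ᵇ-true {m} {n} = dec-true (m <? n)

<ᵇ-weaken : ∀ d {k h h′} → h′ ≤ d + h → (d + k <ᵇ h′) ≡ true → (k <ᵇ h) ≡ true
<ᵇ-weaken d h′≤d+h d+k<h′ = <⇒<ᵇ-true (+-cancelˡ-< d _ _ (<-≤-trans (<ᵇ-true⇒< d+k<h′) h′≤d+h))

-- Sums over initial segments of ℕ

Σ[<_] : ℕ → (ℕ → ℕ) → ℕ
Σ[< zero  ] f = 0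
Σ[< suc n ] f = f 0 + Σ[< n ] (f ∘ suc)

sum-map-applyUpTo : ∀ n (f h : ℕ → ℕ) → sum (map f (applyUpTo h n)) ≡ Σ[< n ] (f ∘ h)
sum-map-applyUpTo zero    f h = refl
sum-map-applyUpTo (suc n) f h = cong (f (h 0) +_) (sum-map-applyUpTo n f (h ∘ suc))

Σ<-cong : ∀ n {f f′ : ℕ → ℕ} → (∀ k → k < n → f k ≡ f′ k) → Σ[< n ] f ≡ Σ[< n ] f′
Σ<-cong zero    f≗f′ = refl
Σ<-cong (suc n) f≗f′ = cong₂ _+_ (f≗f′ 0 z<s) (Σ<-cong n (λ k k<n → f≗f′ (suc k) (s<s k<n)))

sum-map-upTo : ∀ n {f f′ : ℕ → ℕ} → (∀ k → f k ≡ f′ k) → sum (map f (upTo n)) ≡ Σ[< n ] f′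
sum-map-upTo n {f} f≗f′ = trans (sum-map-applyUpTo n f id) (Σ<-cong n (λ k _ → f≗f′ k))

Σ<-truncate : ∀ {f} → m ≤ n → (∀ k → m ≤ k → k < n → f k ≡ 0) → Σ[< n ] f ≡ Σ[< m ] f
Σ<-truncate {n = zero}  z≤n _ = refl
Σ<-truncate {zero} {suc n} z≤n vanish =
  cong₂ _+_ (vanish 0 z≤n z<s) (Σ<-truncate z≤n (λ k _ k<n → vanish (suc k) z≤n (s<s k<n)))
Σ<-truncate {suc m} {suc n} {f} (s≤s m≤n) vanish =
  cong (f 0 +_) (Σ<-truncate m≤n (λ k m≤k k<n → vanish (suc k) (s≤s m≤k) (s<s k<n)))

Σ<-zero : ∀ n {f} → (∀ k → k < n → f k ≡ 0) → Σ[< n ] f ≡ 0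
Σ<-zero n vanish = Σ<-truncate z≤n (λ k _ → vanish k)

Σ<-+ : ∀ n (f f′ : ℕ → ℕ) → Σ[< n ] (λ k → f k + f′ k) ≡ Σ[< n ] f + Σ[< n ] f′
Σ<-+ zero    f f′ = refl
Σ<-+ (suc n) f f′ = trans (cong ((f 0 + f′ 0) +_) (Σ<-+ n (f ∘ suc) (f′ ∘ suc)))
                         (+-interchange (f 0) (f′ 0) _ _)
  where
  +-interchange : ∀ x₁ x₂ x₃ x₄ → (x₁ + x₂) + (x₃ + x₄) ≡ (x₁ + x₃) + (x₂ + x₄)
  +-interchange = solve-∀

Σ<-swap : ∀ m n (f : ℕ → ℕ → ℕ) →
          Σ[< m ] (λ i → Σ[< n ] (f i)) ≡ Σ[< n ] (λ j → Σ[< m ] (λ i → f i j))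
Σ<-swap zero    n f = sym (Σ<-zero n (λ _ _ → refl))
Σ<-swap (suc m) n f = trans (cong (Σ[< n ] (f 0) +_) (Σ<-swap m n (f ∘ suc))) (sym (Σ<-+ n _ _))

Σ<-suc : ∀ n f → Σ[< suc n ] f ≡ Σ[< n ] f + f n
Σ<-suc zero    f = +-comm (f 0) 0
Σ<-suc (suc n) f = trans (cong (f 0 +_) (Σ<-suc n (f ∘ suc))) (sym (+-assoc (f 0) _ _))

Σ<-reverse : ∀ n f → Σ[< n ] f ≡ Σ[< n ] (λ k → f (n ∸ suc k))
Σ<-reverse zero    f = refl
Σ<-reverse (suc n) f =
  trans (Σ<-suc n f) (trans (cong (_+ f n) (Σ<-reverse n f)) (+-comm _ (f n)))

-- Counting the true values of a predicate

χ : Bool → ℕ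
χ x = if x then 1 else 0

count : (ℕ → Bool) → ℕ → ℕ
count p j = Σ[< j ] (χ ∘ p)

χ≤1 : ∀ x → χ x ≤ 1
χ≤1 false = z≤n
χ≤1 true  = ≤-refl

χ-mono : ∀ {x x′} → (x ≡ true → x′ ≡ true) → χ x ≤ χ x′
χ-mono {false}         _    = z≤n
χ-mono {true} {true}   _    = ≤-refl
χ-mono {true} {false}  x⇒x′ with () ← x⇒x′ refl

χ-∧ : ∀ x {x′} → (x′ ≡ true → x ≡ true) → χ (x ∧ x′) ≡ χ x′
χ-∧ false {false} _ = refl
χ-∧ true  {false} _ = refl
χ-∧ true  {true}  _ = refl
χ-∧ false {true}  x′⇒x with () ← x′⇒x refl

count≤ : ∀ p j → count p j ≤ j
count≤ p zero    = z≤n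
count≤ p (suc j) = +-mono-≤ (χ≤1 (p 0)) (count≤ (p ∘ suc) j)

count-<ᵇ : ∀ {m j} → m ≤ j → count (_<ᵇ m) j ≡ m
count-<ᵇ {zero}  {j}     z≤n       = Σ<-zero j (λ _ _ → refl)
count-<ᵇ {suc m} {suc j} (s≤s m≤j) = cong suc (count-<ᵇ m≤j)

count-false : ∀ {p j} → (∀ k → k < j → p k ≡ false) → count p j ≡ 0
count-false {j = j} vanish = Σ<-zero j (λ k k<j → cong χ (vanish k k<j))

count-mono : ∀ {p q j′ j} → j′ ≤ j → (∀ k → k < j′ → p k ≡ true → q k ≡ true) →
             count p j′ ≤ count q j
count-mono {j′ = zero}  _ _ = z≤n
count-mono {p} {q} {suc j′} {suc j} (s≤s j′≤j) p⇒q =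
  +-mono-≤ (χ-mono (p⇒q 0 z<s)) (count-mono j′≤j (λ k k<j′ → p⇒q (suc k) (s<s k<j′)))

count-shift-mono : ∀ d {p q : ℕ → Bool} {j′ j} → j′ ≤ d + j →
                   (∀ k → d + k < j′ → p (d + k) ≡ true → q k ≡ true) →
                   count p j′ ≤ d + count q j
count-shift-mono zero                    = count-mono
count-shift-mono (suc d) {j′ = zero}  _ _ = z≤n
count-shift-mono (suc d) {p} {j′ = suc j′} (s≤s j′≤d+j) p⇒q =
  +-mono-≤ (χ≤1 (p 0)) (count-shift-mono d {p ∘ suc} j′≤d+j (λ k k<j′ → p⇒q k (s<s k<j′)))

DownClosed : ℕ → (ℕ → Bool) → Set
DownClosed j p = ∀ k → suc k < j → p (suc k) ≡ true → p k ≡ true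

down-closed⇒initial : ∀ {p j} → DownClosed j p → ∀ k → k < j → p k ≡ true → p 0 ≡ true
down-closed⇒initial down zero    _   = id
down-closed⇒initial down (suc k) k<j =
  down-closed⇒initial down k (<-trans (n<1+n k) k<j) ∘ down k k<j

count-prefix : ∀ {p j} → DownClosed j p → ∀ k → k < j → p k ≡ (k <ᵇ count p j)
count-prefix {p} {suc j} down k k<j with p 0 in p0
count-prefix {p} {suc j} down zero    _         | true = p0
count-prefix {p} {suc j} down (suc k) (s<s k<j) | true =
  count-prefix {p ∘ suc} (λ k k<j → down (suc k) (s<s k<j)) k k<j
... | false = trans (no-p k k<j) (cong (k <ᵇ_) (sym (count-false {p = p ∘ suc} no-p-suc)))
  where
  no-p : ∀ k → k < suc j → p k ≡ false
  no-p k k<j with p k in pk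
  ... | false = refl
  ... | true with () ← trans (sym p0) (down-closed⇒initial down k k<j pk)
  no-p-suc : ∀ k → k < j → p (suc k) ≡ false
  no-p-suc k k<j = no-p (suc k) (s<s k<j)

data Step : Color → Triple → Triple → Set where
  red    : Step r (a , k , c) (suc a , k , c)
  green  : Step g (a , k , c) (a , suc k , c)
  yellow : Step y (a , k , c) (a , k , suc c)
  blue   : Step b (suc a , k , c) (a , suc k , c)
  orange : Step o (suc a , k , c) (a , k , suc c)
  silver : Step s (a , k , suc c) (a , suc k , c)

+0-inv : ℤ.+ m ≡ ℤ.+ n ℤ.+ ℤ.+ 0 → m ≡ n
+0-inv {n = n} refl = +-identityʳ n

+1-inv : ℤ.+ m ≡ ℤ.+ n ℤ.+ ℤ.+ 1 → m ≡ suc n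
+1-inv {n = n} refl = +-comm n 1

-1-inv : ℤ.+ m ≡ ℤ.+ n ℤ.+ ℤ.- ℤ.+ 1 → n ≡ suc m
-1-inv {n = suc n} refl = refl

isSum⇒Step : ∀ col {u w} → IsSum u (vec col) w → Step col u w
isSum⇒Step r {_ , _ , _} {_ , _ , _} (e₁ , e₂ , e₃)
  with refl ← +1-inv e₁ | refl ← +0-inv e₂ | refl ← +0-inv e₃ = red
isSum⇒Step g {_ , _ , _} {_ , _ , _} (e₁ , e₂ , e₃)
  with refl ← +0-inv e₁ | refl ← +1-inv e₂ | refl ← +0-inv e₃ = green
isSum⇒Step y {_ , _ , _} {_ , _ , _} (e₁ , e₂ , e₃)
  with refl ← +0-inv e₁ | refl ← +0-inv e₂ | refl ← +1-inv e₃ = yellow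
isSum⇒Step b {a , _ , _} {_ , _ , _} (e₁ , e₂ , e₃)
  with refl ← -1-inv {n = a} e₁ | refl ← +1-inv e₂ | refl ← +0-inv e₃ = blue
isSum⇒Step o {a , _ , _} {_ , _ , _} (e₁ , e₂ , e₃)
  with refl ← -1-inv {n = a} e₁ | refl ← +0-inv e₂ | refl ← +1-inv e₃ = orange
isSum⇒Step s {_ , _ , c} {_ , _ , _} (e₁ , e₂ , e₃)
  with refl ← +0-inv e₁ | refl ← +1-inv e₂ | refl ← -1-inv {n = c} e₃ = silver

+0-intro : ∀ m → ℤ.+ m ≡ ℤ.+ m ℤ.+ ℤ.+ 0
+0-intro m = cong ℤ.+_ (sym (+-identityʳ m))

+1-intro : ∀ m → ℤ.+ suc m ≡ ℤ.+ m ℤ.+ ℤ.+ 1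
+1-intro m = cong ℤ.+_ (+-comm 1 m)

Step⇒isSum : Step col u w → IsSum u (vec col) w
Step⇒isSum (red    {a} {k} {c}) = +1-intro a , +0-intro k , +0-intro c
Step⇒isSum (green  {a} {k} {c}) = +0-intro a , +1-intro k , +0-intro c
Step⇒isSum (yellow {a} {k} {c}) = +0-intro a , +0-intro k , +1-intro c
Step⇒isSum (blue   {a} {k} {c}) = refl       , +1-intro k , +0-intro c
Step⇒isSum (orange {a} {k} {c}) = refl       , +0-intro k , +1-intro c
Step⇒isSum (silver {a} {k} {c}) = +0-intro a , +1-intro k , refl

StepClosed : ColorSet → ℕ → (Triple → Bool) → Set
StepClosed S n I =
  ∀ {col u w} → col ∈S S → Step col u w → InT n u → InT n w → I w ≡ true → I u ≡ true

stepClosed⇒isIdeal : StepClosed S n I → IsIdeal S n I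
stepClosed⇒isIdeal {S} {n} {I} closed _ _ _ _ = below
  where
  below : ∀ {u w} → u ≼[ S , n ] w → I w ≡ true → I u ≡ true
  below ε                                    = id
  below ((tu , tv , col , col∈S , sum) ◅ v≼w) = closed col∈S (isSum⇒Step col sum) tu tv ∘ below v≼w

isIdeal⇒stepClosed : IsIdeal S n I → StepClosed S n I
isIdeal⇒stepClosed ideal {col} col∈S step tu tw =
  ideal _ _ tu tw ((tu , tw , col , col∈S , Step⇒isSum step) ◅ ε)

InRange Orange Red Yellow Blue Silver : ℕ → Array → Set
InRange n Y = ∀ i j → InDom n i j → i ≤ Y i j × Y i j ≤ i + j
Orange  n Y = ∀ i j → InDom n i j → InDom n (suc i) j → Y i j < Y (suc i) j
Red     n Y = ∀ i j → InDom n (suc i) j → InDom n i (suc j) → Y (suc i) j ≤ Y i (suc j) + 1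
Yellow  n Y = ∀ i j → InDom n i j → InDom n i (suc j) → Y i j ≤ Y i (suc j)
Blue    n Y = ∀ i j → InDom n i (suc j) → InDom n (suc i) j → Y i (suc j) ≤ Y (suc i) j
Silver  n Y = ∀ i j → InDom n i (suc j) → InDom n i j → Y i (suc j) ≤ Y i j + 1

-- Arrays as heights of the fibres of T_n

module Fibres (n : ℕ) where

  -- The cell (suc a , j) of an array carries the fibre {(a , k , column a j) | k < j} of T_n,
  -- and (a , k , c) lies in the fibre of the cell (suc a , column a c).
  column : ℕ → ℕ → ℕ
  column a c = n ∸ (suc a + c)

  <column⇒inT : ∀ a k c → k < column a c → InT n (a , k , c)
  <column⇒inT a k c k<col = subst (_≤ n) (sym (reassoc a k c)) (<∸⇒+< (suc a + c) k<col)
    where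
    reassoc : ∀ a k c → a + k + c + 2 ≡ suc (suc a + c + k)
    reassoc = solve-∀

  inT⇒<column : ∀ a k c → InT n (a , k , c) → k < column a c
  inT⇒<column a k c t = m+n≤o⇒m≤o∸n (suc k) (subst (_≤ n) (reassoc a k c) t)
    where
    reassoc : ∀ a k c → a + k + c + 2 ≡ suc k + (suc a + c)
    reassoc = solve-∀

  inT⇒≤ : ∀ a k c → InT n (a , k , c) → suc a + c ≤ n
  inT⇒≤ a k c t = m+n≤o⇒m≤o (suc a + c) (<⇒≤ (<∸⇒+< (suc a + c) (inT⇒<column a k c t)))

  inT⇒inDom : ∀ a k c → InT n (a , k , c) → InDom n (suc a) (column a c)
  inT⇒inDom a k c t = z<s , ≤-<-trans z≤n (inT⇒<column a k c t) , (begin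
    suc a + column a c      ≤⟨ +-monoˡ-≤ (column a c) (m≤m+n (suc a) c) ⟩
    suc a + c + column a c  ≡⟨ m+[n∸m]≡n (inT⇒≤ a k c t) ⟩
    n                       ∎)
    where open ≤-Reasoning

  column-involutive : ∀ a c → suc a + c ≤ n → column a (column a c) ≡ c
  column-involutive a c a+c≤n = begin
    n ∸ (suc a + (n ∸ (suc a + c)))  ≡⟨ ∸-+-assoc n (suc a) _ ⟨
    n ∸ suc a ∸ (n ∸ (suc a + c))    ≡⟨ cong (n ∸ suc a ∸_) (∸-+-assoc n (suc a) c) ⟨
    n ∸ suc a ∸ (n ∸ suc a ∸ c)      ≡⟨ m∸[m∸n]≡n c≤n-a ⟩
    c                                ∎
    where
    open ≡-Reasoning
    c≤n-a = m+n≤o⇒m≤o∸n c (subst (_≤ n) (+-comm (suc a) c) a+c≤n)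

  inDom⇒inT : ∀ a j k → InDom n (suc a) j → k < j → InT n (a , k , column a j)
  inDom⇒inT a j k (_ , _ , a+j≤n) k<j =
    <column⇒inT a k (column a j) (subst (k <_) (sym (column-involutive a j a+j≤n)) k<j)

  column-shift : ∀ a c → column a (suc c) ≡ column (suc a) c
  column-shift a c = cong (n ∸_) (+-suc (suc a) c)

  column-pred : ∀ a c → suc (suc a) + c ≤ n → column a c ≡ suc (column (suc a) c)
  column-pred a c = ∸-suc

  column-predʳ : ∀ a c → suc a + suc c ≤ n → column a c ≡ suc (column a (suc c))
  column-predʳ a c a+c<n = trans (column-pred a c (subst (_≤ n) (+-suc (suc a) c) a+c<n))
                                 (cong suc (sym (column-shift a c)))

  height : Array → ℕ → ℕ → ℕ
  height Y a c = Y (suc a) (column a c) ∸ suc a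

  toIdeal : Array → Triple → Bool
  toIdeal Y (a , k , c) = k <ᵇ height Y a c

  module _ {Y : Array} where

    height-red : Red n Y → ∀ a k c → InT n (a , k , c) → InT n (suc a , k , c) →
                 height Y (suc a) c ≤ height Y a c
    height-red red-Y a k c tu tw = begin
      Y (suc (suc a)) j ∸ suc (suc a)  ≤⟨ ∸-monoˡ-≤ (suc (suc a)) red-ineq ⟩
      Y (suc a) (suc j) ∸ suc a        ≡⟨ cong (λ j′ → Y (suc a) j′ ∸ suc a) j+1 ⟨
      height Y a c                     ∎
      where
      open ≤-Reasoning
      j = column (suc a) c
      j+1 : column a c ≡ suc j
      j+1 = column-pred a c (inT⇒≤ (suc a) k c tw)
      red-ineq : Y (suc (suc a)) j ≤ suc (Y (suc a) (suc j))
      red-ineq = ≤-trans (red-Y (suc a) j (inT⇒inDom (suc a) k c tw)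
                                          (subst (InDom n (suc a)) j+1 (inT⇒inDom a k c tu)))
                         (≤-reflexive (+-comm _ 1))

    height-yellow : Yellow n Y → ∀ a k c → InT n (a , k , c) → InT n (a , k , suc c) →
                    height Y a (suc c) ≤ height Y a c
    height-yellow yellow-Y a k c tu tw = begin
      Y (suc a) j ∸ suc a          ≤⟨ ∸-monoˡ-≤ (suc a) yellow-ineq ⟩
      Y (suc a) (suc j) ∸ suc a    ≡⟨ cong (λ j′ → Y (suc a) j′ ∸ suc a) j+1 ⟨
      height Y a c                 ∎
      where
      open ≤-Reasoning
      j = column a (suc c)
      j+1 : column a c ≡ suc j
      j+1 = column-predʳ a c (inT⇒≤ a k (suc c) tw)
      yellow-ineq : Y (suc a) j ≤ Y (suc a) (suc j)
      yellow-ineq = yellow-Y (suc a) j (inT⇒inDom a k (suc c) tw)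
                                       (subst (InDom n (suc a)) j+1 (inT⇒inDom a k c tu))

    height-orange : Orange n Y → ∀ a k c → InT n (suc a , k , c) → InT n (a , k , suc c) →
                    height Y a (suc c) ≤ height Y (suc a) c
    height-orange orange-Y a k c tu tw = begin
      height Y a (suc c)                ≡⟨ cong (λ j′ → Y (suc a) j′ ∸ suc a) (column-shift a c) ⟩
      Y (suc a) j ∸ suc a               ≤⟨ ∸-monoˡ-≤ (suc (suc a)) orange-ineq ⟩
      Y (suc (suc a)) j ∸ suc (suc a)   ∎
      where
      open ≤-Reasoning
      j = column (suc a) c
      orange-ineq : Y (suc a) j < Y (suc (suc a)) j
      orange-ineq = orange-Y (suc a) j
                      (subst (InDom n (suc a)) (column-shift a c) (inT⇒inDom a k (suc c) tw))
                                       (inT⇒inDom (suc a) k c tu)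

    height-blue : Blue n Y → ∀ a k c → InT n (suc a , k , c) → InT n (a , suc k , c) →
                  height Y a c ≤ 1 + height Y (suc a) c
    height-blue blue-Y a k c tu tw = begin
      height Y a c                      ≡⟨ cong (λ j′ → Y (suc a) j′ ∸ suc a) j+1 ⟩
      Y (suc a) (suc j) ∸ suc a         ≤⟨ ∸-≤-suc∸suc (suc a) blue-ineq ⟩
      1 + height Y (suc a) c            ∎
      where
      open ≤-Reasoning
      j = column (suc a) c
      j+1 : column a c ≡ suc j
      j+1 = column-pred a c (inT⇒≤ (suc a) k c tu)
      blue-ineq : Y (suc a) (suc j) ≤ Y (suc (suc a)) j
      blue-ineq = blue-Y (suc a) j (subst (InDom n (suc a)) j+1 (inT⇒inDom a (suc k) c tw))
                                   (inT⇒inDom (suc a) k c tu)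

    height-silver : Silver n Y → ∀ a k c → InT n (a , k , suc c) → InT n (a , suc k , c) →
                    height Y a c ≤ 1 + height Y a (suc c)
    height-silver silver-Y a k c tu tw = begin
      height Y a c                      ≡⟨ cong (λ j′ → Y (suc a) j′ ∸ suc a) j+1 ⟩
      Y (suc a) (suc j) ∸ suc a         ≤⟨ ∸-≤-suc∸suc (suc a) silver-ineq ⟩
      1 + height Y a (suc c)            ∎
      where
      open ≤-Reasoning
      j = column a (suc c)
      j+1 : column a c ≡ suc j
      j+1 = column-predʳ a c (inT⇒≤ a k (suc c) tu)
      silver-ineq : Y (suc a) (suc j) ≤ suc (Y (suc a) j)
      silver-ineq = ≤-trans (silver-Y (suc a) j
                               (subst (InDom n (suc a)) j+1 (inT⇒inDom a (suc k) c tw))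
                               (inT⇒inDom a k (suc c) tu))
                            (≤-reflexive (+-comm _ 1))

    toIdeal-closed : InY S n Y → StepClosed S n (toIdeal Y)
    toIdeal-closed _                        _   (green  {a} {k} {c}) _  _  =
      <ᵇ-weaken 1 {h = height Y a c} (n≤1+n _)
    toIdeal-closed (_ , _ , r⇒ , _ , _ , _) r∈S (red    {a} {k} {c}) tu tw =
      <ᵇ-weaken 0 (height-red (r⇒ r∈S) a k c tu tw)
    toIdeal-closed (_ , _ , _ , y⇒ , _ , _) y∈S (yellow {a} {k} {c}) tu tw =
      <ᵇ-weaken 0 (height-yellow (y⇒ y∈S) a k c tu tw)
    toIdeal-closed (_ , o⇒ , _ , _ , _ , _) o∈S (orange {a} {k} {c}) tu tw =
      <ᵇ-weaken 0 (height-orange (o⇒ o∈S) a k c tu tw)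
    toIdeal-closed (_ , _ , _ , _ , b⇒ , _) b∈S (blue   {a} {k} {c}) tu tw =
      <ᵇ-weaken 1 (height-blue (b⇒ b∈S) a k c tu tw)
    toIdeal-closed (_ , _ , _ , _ , _ , s⇒) s∈S (silver {a} {k} {c}) tu tw =
      <ᵇ-weaken 1 (height-silver (s⇒ s∈S) a k c tu tw)

  fibre : (Triple → Bool) → ℕ → ℕ → ℕ → Bool
  fibre I a j k = I (a , k , column a j)

  -- Row 0 lies outside the index domain, so its value is irrelevant.
  fromIdeal : (Triple → Bool) → Array
  fromIdeal I zero    j = 0
  fromIdeal I (suc a) j = suc a + count (fibre I a j) j

  fromIdeal-inRange : ∀ I → InRange n (fromIdeal I)
  fromIdeal-inRange I (suc a) j _ = m≤m+n (suc a) _ , +-monoʳ-≤ (suc a) (count≤ (fibre I a j) j)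

  module _ {S I} (closed : StepClosed S n I) where

    fromIdeal-orange : o ∈S S → Orange n (fromIdeal I)
    fromIdeal-orange o∈S (suc a) j cell cell′ =
      s≤s (+-monoʳ-≤ (suc a) (count-mono ≤-refl fibre⇒fibre))
      where
      j+1 : column a j ≡ suc (column (suc a) j)
      j+1 = column-pred a j (proj₂ (proj₂ cell′))
      fibre⇒fibre : ∀ k → k < j → fibre I a j k ≡ true → fibre I (suc a) j k ≡ true
      fibre⇒fibre k k<j =
        closed o∈S orange (inDom⇒inT (suc a) j k cell′ k<j)
                          (subst (λ c → InT n (a , k , c)) j+1 (inDom⇒inT a j k cell k<j))
        ∘ subst (λ c → I (a , k , c) ≡ true) j+1

    fromIdeal-red : r ∈S S → Red n (fromIdeal I)
    fromIdeal-red r∈S (suc a) j cell cell′ = begin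
      suc (suc a + count (fibre I (suc a) j) j)        ≤⟨ s≤s (+-monoʳ-≤ (suc a) counts≤) ⟩
      suc (suc a + count (fibre I a (suc j)) (suc j))  ≡⟨ +-comm 1 _ ⟩
      suc a + count (fibre I a (suc j)) (suc j) + 1    ∎
      where
      open ≤-Reasoning
      fibre⇒fibre : ∀ k → k < j → fibre I (suc a) j k ≡ true → fibre I a (suc j) k ≡ true
      fibre⇒fibre k k<j =
        subst (λ c → I (a , k , c) ≡ true) (sym (column-shift a j))
        ∘ closed r∈S red (subst (λ c → InT n (a , k , c)) (column-shift a j)
                                (inDom⇒inT a (suc j) k cell′ (<-trans k<j (n<1+n j))))
                         (inDom⇒inT (suc a) j k cell k<j)
      counts≤ = count-mono (n≤1+n j) fibre⇒fibre

    fromIdeal-yellow : y ∈S S → Yellow n (fromIdeal I)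
    fromIdeal-yellow y∈S (suc a) j cell cell′ =
      +-monoʳ-≤ (suc a) (count-mono (n≤1+n j) fibre⇒fibre)
      where
      j+1 : column a j ≡ suc (column a (suc j))
      j+1 = column-predʳ a j (proj₂ (proj₂ cell′))
      fibre⇒fibre : ∀ k → k < j → fibre I a j k ≡ true → fibre I a (suc j) k ≡ true
      fibre⇒fibre k k<j =
        closed y∈S yellow (inDom⇒inT a (suc j) k cell′ (<-trans k<j (n<1+n j)))
                          (subst (λ c → InT n (a , k , c)) j+1 (inDom⇒inT a j k cell k<j))
        ∘ subst (λ c → I (a , k , c) ≡ true) j+1

    fromIdeal-blue : b ∈S S → Blue n (fromIdeal I)
    fromIdeal-blue b∈S (suc a) j cell cell′ = begin
      suc a + count (fibre I a (suc j)) (suc j)  ≤⟨ +-monoʳ-≤ (suc a) counts≤ ⟩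
      suc a + suc (count (fibre I (suc a) j) j)  ≡⟨ +-suc (suc a) _ ⟩
      suc (suc a) + count (fibre I (suc a) j) j  ∎
      where
      open ≤-Reasoning
      fibre⇒fibre : ∀ k → suc k < suc j →
                    fibre I a (suc j) (suc k) ≡ true → fibre I (suc a) j k ≡ true
      fibre⇒fibre k (s<s k<j) =
        closed b∈S blue (inDom⇒inT (suc a) j k cell′ k<j)
                        (subst (λ c → InT n (a , suc k , c)) (column-shift a j)
                               (inDom⇒inT a (suc j) (suc k) cell (s<s k<j)))
        ∘ subst (λ c → I (a , suc k , c) ≡ true) (column-shift a j)
      counts≤ = count-shift-mono 1 {fibre I a (suc j)} ≤-refl fibre⇒fibre

    fromIdeal-silver : s ∈S S → Silver n (fromIdeal I)
    fromIdeal-silver s∈S (suc a) j cell cell′ = begin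
      suc a + count (fibre I a (suc j)) (suc j)  ≤⟨ +-monoʳ-≤ (suc a) counts≤ ⟩
      suc a + suc (count (fibre I a j) j)        ≡⟨ +-suc (suc a) _ ⟩
      suc (suc a + count (fibre I a j) j)        ≡⟨ +-comm 1 _ ⟩
      suc a + count (fibre I a j) j + 1          ∎
      where
      open ≤-Reasoning
      j+1 : column a j ≡ suc (column a (suc j))
      j+1 = column-predʳ a j (proj₂ (proj₂ cell))
      fibre⇒fibre : ∀ k → suc k < suc j → fibre I a (suc j) (suc k) ≡ true → fibre I a j k ≡ true
      fibre⇒fibre k (s<s k<j) =
        subst (λ c → I (a , k , c) ≡ true) (sym j+1)
        ∘ closed s∈S silver (subst (λ c → InT n (a , k , c)) j+1 (inDom⇒inT a j k cell′ k<j))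
                            (inDom⇒inT a (suc j) (suc k) cell (s<s k<j))
      counts≤ = count-shift-mono 1 {fibre I a (suc j)} ≤-refl fibre⇒fibre

    fromIdeal-inY : InY S n (fromIdeal I)
    fromIdeal-inY = fromIdeal-inRange I , fromIdeal-orange , fromIdeal-red , fromIdeal-yellow
                  , fromIdeal-blue , fromIdeal-silver

  fromIdeal-toIdeal : InRange n Y → ∀ i j → InDom n i j → fromIdeal (toIdeal Y) i j ≡ Y i j
  fromIdeal-toIdeal {Y} range (suc a) j cell@(_ , _ , a+j≤n) = begin
    suc a + count (_<ᵇ height Y a (column a j)) j  ≡⟨ cong (suc a +_) (count-<ᵇ height≤j) ⟩
    suc a + height Y a (column a j)                ≡⟨ cong (λ j′ → suc a + (Y (suc a) j′ ∸ suc a))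
                                                           column² ⟩
    suc a + (Y (suc a) j ∸ suc a)                  ≡⟨ m+[n∸m]≡n (proj₁ (range (suc a) j cell)) ⟩
    Y (suc a) j                                    ∎
    where
    open ≡-Reasoning
    column² = column-involutive a j a+j≤n
    height≤j : height Y a (column a j) ≤ j
    height≤j = subst (λ j′ → Y (suc a) j′ ∸ suc a ≤ j) (sym column²)
                     (m≤n+o⇒m∸n≤o _ (suc a) (proj₂ (range (suc a) j cell)))

  toIdeal-fromIdeal : ∀ {S I} → g ∈S S → StepClosed S n I →
                      ∀ u → InT n u → toIdeal (fromIdeal I) u ≡ I u
  toIdeal-fromIdeal {I = I} g∈S closed (a , k , c) t = begin
    k <ᵇ (suc a + count (fibre I a j) j ∸ suc a)  ≡⟨ cong (k <ᵇ_) (m+n∸m≡n (suc a) _) ⟩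
    k <ᵇ count (fibre I a j) j                    ≡⟨ cong (λ c′ → k <ᵇ count (at-depth c′) j) column² ⟩
    k <ᵇ count (at-depth c) j                     ≡⟨ count-prefix down k (inT⇒<column a k c t) ⟨
    I (a , k , c)                                 ∎
    where
    open ≡-Reasoning
    j = column a c
    column² = column-involutive a c (inT⇒≤ a k c t)
    at-depth : ℕ → ℕ → Bool
    at-depth c′ k′ = I (a , k′ , c′)
    down : DownClosed j (at-depth c)
    down k′ k′+1<j = closed g∈S green (<column⇒inT a k′ c (<-trans (n<1+n k′) k′+1<j))
                                     (<column⇒inT a (suc k′) c k′+1<j)

  toIdeal-cong : ∀ {Y Y′} → (∀ i j → InDom n i j → Y i j ≡ Y′ i j) →
                 ∀ u → InT n u → toIdeal Y u ≡ toIdeal Y′ u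
  toIdeal-cong Y≈Y′ (a , k , c) t =
    cong (λ x → k <ᵇ (x ∸ suc a)) (Y≈Y′ (suc a) (column a c) (inT⇒inDom a k c t))

  fromIdeal-cong : ∀ {I I′} → (∀ u → InT n u → I u ≡ I′ u) →
                   ∀ i j → InDom n i j → fromIdeal I i j ≡ fromIdeal I′ i j
  fromIdeal-cong I≈I′ (suc a) j cell =
    cong (suc a +_) (Σ<-cong j (λ k k<j → cong χ (I≈I′ _ (inDom⇒inT a j k cell k<j))))

  inT? : Triple → Bool
  inT? (a , k , c) = a + k + c + 2 ≤ᵇ n

  card≡Σ< : ∀ I → card n I ≡
            Σ[< n ] λ a → Σ[< n ] λ k → Σ[< n ] λ c → χ (inT? (a , k , c) ∧ I (a , k , c))
  card≡Σ< I = sum-map-upTo n λ a → sum-map-upTo n λ k → sum-map-upTo n λ c → refl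

  stat≡Σ< : ∀ Y → stat n Y ≡ Σ[< n ∸ 1 ] λ a → Σ[< n ∸ suc a ] λ j → Y (suc a) (suc j) ∸ suc a
  stat≡Σ< Y = sum-map-upTo (n ∸ 1) λ a → sum-map-upTo (n ∸ suc a) λ j → refl

  fibre-size : InRange n Y → ∀ a c → c < n ∸ suc a →
               Σ[< n ] (λ k → χ (inT? (a , k , c) ∧ toIdeal Y (a , k , c))) ≡ height Y a c
  fibre-size {Y} range a c c<n-a = begin
    Σ[< n ] (λ k → χ (inT? (a , k , c) ∧ (k <ᵇ h)))  ≡⟨ Σ<-cong n (λ k _ → χ-∧ _ (inT-below k)) ⟩
    count (_<ᵇ h) n                                 ≡⟨ count-<ᵇ (≤-trans h≤column (m∸n≤m n (suc a + c))) ⟩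
    h                                               ∎
    where
    open ≡-Reasoning
    h = height Y a c
    0<column : 0 < column a c
    0<column = subst (0 <_) (∸-+-assoc n (suc a) c) (m<n⇒0<n∸m c<n-a)
    h≤column : h ≤ column a c
    h≤column = m≤n+o⇒m∸n≤o _ (suc a)
                 (proj₂ (range (suc a) (column a c) (inT⇒inDom a 0 c (<column⇒inT a 0 c 0<column))))
    inT-below : ∀ k → (k <ᵇ h) ≡ true → inT? (a , k , c) ≡ true
    inT-below k k<h = dec-true (_ ≤? n) (<column⇒inT a k c (<-≤-trans (<ᵇ-true⇒< k<h) h≤column))

  fibre-empty : ∀ (I : Triple → Bool) a c → n ∸ suc a ≤ c →
                ∀ k → χ (inT? (a , k , c) ∧ I (a , k , c)) ≡ 0
  fibre-empty I a c n-a≤c k = cong (λ x → χ (x ∧ I (a , k , c))) (dec-false (_ ≤? n) outside)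
    where
    column≡0 : column a c ≡ 0
    column≡0 = trans (sym (∸-+-assoc n (suc a) c)) (m≤n⇒m∸n≡0 n-a≤c)
    outside : ¬ InT n (a , k , c)
    outside t = n≮0 (subst (k <_) column≡0 (inT⇒<column a k c t))

  column-reverse : ∀ a j → j < n ∸ suc a → column a (n ∸ suc a ∸ suc j) ≡ suc j
  column-reverse a j j<n-a =
    trans (cong (column a) (∸-+-assoc n (suc a) (suc j)))
          (column-involutive a (suc j) (subst (_≤ n) (sym (+-suc (suc a) j)) (<∸⇒+< (suc a) j<n-a)))

  row-size : InRange n Y → ∀ a →
             Σ[< n ] (λ k → Σ[< n ] λ c → χ (inT? (a , k , c) ∧ toIdeal Y (a , k , c)))
             ≡ Σ[< n ∸ suc a ] λ j → Y (suc a) (suc j) ∸ suc a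
  row-size {Y} range a = begin
    Σ[< n ] (λ k → Σ[< n ] λ c → T k c)      ≡⟨ Σ<-swap n n T ⟩
    Σ[< n ] (λ c → Σ[< n ] λ k → T k c)      ≡⟨ Σ<-truncate (m∸n≤m n (suc a)) empty-fibre ⟩
    Σ[< N ] (λ c → Σ[< n ] λ k → T k c)      ≡⟨ Σ<-cong N (λ c → fibre-size range a c) ⟩
    Σ[< N ] (height Y a)                     ≡⟨ Σ<-reverse N (height Y a) ⟩
    Σ[< N ] (λ j → height Y a (N ∸ suc j))   ≡⟨ Σ<-cong N reversed-height ⟩
    Σ[< N ] (λ j → Y (suc a) (suc j) ∸ suc a) ∎
    where
    open ≡-Reasoning
    N = n ∸ suc a
    T : ℕ → ℕ → ℕ
    T k c = χ (inT? (a , k , c) ∧ toIdeal Y (a , k , c))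
    empty-fibre : ∀ c → N ≤ c → c < n → Σ[< n ] (λ k → T k c) ≡ 0
    empty-fibre c N≤c _ = Σ<-zero n (λ k _ → fibre-empty (toIdeal Y) a c N≤c k)
    reversed-height : ∀ j → j < N → height Y a (N ∸ suc j) ≡ Y (suc a) (suc j) ∸ suc a
    reversed-height j j<N = cong (λ j′ → Y (suc a) j′ ∸ suc a) (column-reverse a j j<N)

  stat≡card : InRange n Y → stat n Y ≡ card n (toIdeal Y)
  stat≡card {Y} range = begin
    stat n Y             ≡⟨ stat≡Σ< Y ⟩
    Σ[< n ∸ 1 ] row      ≡⟨ Σ<-truncate (m∸n≤m n 1) empty-row ⟨
    Σ[< n ] row          ≡⟨ Σ<-cong n (λ a _ → row-size range a) ⟨
    Σ[< n ] (λ a → Σ[< n ] λ k → Σ[< n ] λ c → χ (inT? (a , k , c) ∧ toIdeal Y (a , k , c)))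
                         ≡⟨ card≡Σ< (toIdeal Y) ⟨
    card n (toIdeal Y)   ∎
    where
    open ≡-Reasoning
    row : ℕ → ℕ
    row a = Σ[< n ∸ suc a ] λ j → Y (suc a) (suc j) ∸ suc a
    empty-row : ∀ a → n ∸ 1 ≤ a → a < n → row a ≡ 0
    empty-row a n-1≤a _ = cong (λ N → Σ[< N ] λ j → Y (suc a) (suc j) ∸ suc a)
                               (trans (sym (∸-+-assoc n 1 a)) (m≤n⇒m∸n≡0 n-1≤a))

  toIdealₛ : Σ Array (InY S n) → Σ (Triple → Bool) (IsIdeal S n)
  toIdealₛ {S} (Y , Y∈) = toIdeal Y , stepClosed⇒isIdeal (toIdeal-closed {S = S} Y∈)

  fromIdealₛ : Σ (Triple → Bool) (IsIdeal S n) → Σ Array (InY S n)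
  fromIdealₛ {S} (I , ideal) = fromIdeal I , fromIdeal-inY (isIdeal⇒stepClosed {S} ideal)

  toIdealₛ-inverseˡ : g ∈S S →
    Inverseˡ (Setoid._≈_ (Y-Setoid S n)) (Setoid._≈_ (J-Setoid S n)) (toIdealₛ {S}) (fromIdealₛ {S})
  toIdealₛ-inverseˡ {S} g∈S {I , ideal} Y≈ u t =
    trans (toIdeal-cong Y≈ u t) (toIdeal-fromIdeal g∈S (isIdeal⇒stepClosed {S} ideal) u t)

  fromIdealₛ-inverseʳ :
    Inverseʳ (Setoid._≈_ (Y-Setoid S n)) (Setoid._≈_ (J-Setoid S n)) (toIdealₛ {S}) (fromIdealₛ {S})
  fromIdealₛ-inverseʳ {x = _ , Y∈} I≈ i j cell =
    trans (fromIdeal-cong I≈ i j cell) (fromIdeal-toIdeal (proj₁ Y∈) i j cell)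

  arrays↔ideals : ∀ {S} → g ∈S S → Inverse (Y-Setoid S n) (J-Setoid S n)
  arrays↔ideals {S} g∈S = record
    { to        = toIdealₛ
    ; from      = fromIdealₛ
    ; to-cong   = λ {Y} {Y′} → toIdeal-cong {proj₁ Y} {proj₁ Y′}
    ; from-cong = λ {I} {I′} → fromIdeal-cong {proj₁ I} {proj₁ I′}
    ; inverse   = (λ {I} {Y} → toIdealₛ-inverseˡ g∈S {I} {Y})
                , (λ {Y} {I} → fromIdealₛ-inverseʳ {S} {Y} {I})
    }

proposition2p14 : (n : ℕ) → 1 ≤ n → (S : ColorSet) → Admissible S → g ∈S S →
    Σ (Bijection (Y-Setoid S n) (J-Setoid S n)) (λ φ →
      ∀ Y → stat n (proj₁ Y) ≡ card n (proj₁ (Bijection.to φ Y)))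
proposition2p14 n _ S _ g∈S =
  Inverse⇒Bijection (arrays↔ideals g∈S) , λ (_ , Y∈) → stat≡card (proj₁ Y∈)
  where open Fibres n
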